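{- Let $G$ and $H$ be finite simple graphs, let $f_1=(A_0,A_1,A_2)$ be a Roman dominating function on $G$ of weight $\gamma_R(G)$, and let $f_2=(B_0,B_1,B_2)$ be a Roman dominating function on $H$ of weight $\gamma_R(H)$. Then $$\gamma_R(G\boxtimes H)\le \gamma_R(G)\gamma_R(H)-2|A_2||B_2|.$$
   Context: A Roman dominating function on a graph $X$ is a map $f:V(X)\to\{0,1,2\}$ such that every vertex $v$ with $f(v)=0$ has a neighbor $u$ with $f(u)=2$; its weight is $\sum_v f(v)$ and $\gamma_R(X)$ is the minimum weight. We write $f=(C_0,C_1,C_2)$ with $C_i=\{v: f(v)=i\}$. The strong product $G\boxtimes H$ has vertex set $V(G)\times V(H)$, with distinct $(g,h),(g',h')$ adjacent iff ($g=g'$ and $h\sim h'$) or ($g\sim g'$ and $h=h'$) or ($g\sim g'$ and $h\sim h'$). -}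

module Defs where

open import Data.Nat using (ℕ; zero; suc; _*_) renaming (_≤_ to _≤ℕ_)
open import Data.Fin using (Fin; zero; suc; remQuot)
open import Data.Vec using (sum; tabulate)
open import Data.Product using (Σ; ∃; _×_; _,_; proj₁; proj₂)
open import Data.Sum using (_⊎_; inj₁; inj₂)
open import Level using (0ℓ)
open import Relation.Nullary using (¬_)
open import Relation.Binary.PropositionalEquality using (_≡_; _≢_; refl; sym)

record Graph : Set₁ where
  field
    n      : ℕ
    Adj    : Fin n → Fin n → Set
    adj-sym    : ∀ {u v} → Adj u v → Adj v u
    adj-irrefl : ∀ {v} → ¬ Adj v v
open Graph public

Label : Set
Label = Fin 3

val : Label → ℕ
val zero = 0
val (suc zero) = 1
val (suc (suc zero)) = 2

isTwo : Label → ℕ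
isTwo (suc (suc zero)) = 1
isTwo _ = 0

weight : (G : Graph) → (Fin (n G) → Label) → ℕ
weight G f = sum (tabulate (λ v → val (f v)))

card₂ : (G : Graph) → (Fin (n G) → Label) → ℕ
card₂ G f = sum (tabulate (λ v → isTwo (f v)))

two : Label
two = suc (suc zero)

IsRDF : (G : Graph) → (Fin (n G) → Label) → Set
IsRDF G f = ∀ v → f v ≡ zero → ∃ λ u → Adj G v u × f u ≡ two

IsMinRDF : (G : Graph) → (Fin (n G) → Label) → Set
IsMinRDF G f = IsRDF G f × (∀ g → IsRDF G g → weight G f ≤ℕ weight G g)

IsRomanDomNumber : Graph → ℕ → Set
IsRomanDomNumber G k =
  (∃ λ f → IsRDF G f × weight G f ≡ k) × (∀ g → IsRDF G g → k ≤ℕ weight G g)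

-- Strong product; vertex (g,h) is encoded in Fin (n G * n H) via remQuot/combine.
StrongAdj : (G H : Graph) → Fin (n G * n H) → Fin (n G * n H) → Set
StrongAdj G H x y =
  x ≢ y
  × (proj₁ (remQuot {n G} (n H) x) ≡ proj₁ (remQuot {n G} (n H) y)
       ⊎ Adj G (proj₁ (remQuot {n G} (n H) x)) (proj₁ (remQuot {n G} (n H) y)))
  × (proj₂ (remQuot {n G} (n H) x) ≡ proj₂ (remQuot {n G} (n H) y)
       ⊎ Adj H (proj₂ (remQuot {n G} (n H) x)) (proj₂ (remQuot {n G} (n H) y)))

_⊠_ : Graph → Graph → Graph
G ⊠ H = record
  { n = n G * n H
  ; Adj = StrongAdj G H
  ; adj-sym = λ { (ne , a , b) → (λ e → ne (sym e)) , sw G a , sw H b }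
  ; adj-irrefl = λ { (ne , _ , _) → ne refl }
  }
  where
  sw : (K : Graph) → ∀ {a b} → (a ≡ b ⊎ Adj K a b) → (b ≡ a ⊎ Adj K b a)
  sw K (inj₁ e) = inj₁ (sym e)
  sw K (inj₂ p) = inj₂ (adj-sym K p)

Fin' : Graph → Set
Fin' G = Fin (n G)

-- Label (g , h) by min 2 (f₁ g · f₂ h).  A product vertex labelled 0 has a factor
-- labelled 0; moving every zero coordinate to a neighbour labelled 2 in its factor
-- gives a strong-product neighbour whose label is a capped product of two positive
-- labels, one of them 2, i.e. 2.  The weight is ∑ f₁ g · f₂ h = w(f₁) w(f₂), except
-- that each of the |A₂| |B₂| vertices with both labels 2 carries 2 instead of 4.
module Submission where

open import Defs
open import Data.Nat using (ℕ; _*_; _∸_; _≤_; _+_)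
open import Data.Nat.Properties using (+-*-semiring; +-assoc; m+n∸n≡m; ≤-trans; ≤-reflexive)
open import Algebra.Properties.Semiring.Sum +-*-semiring
  using (sum-cong-≗; ∑-distrib-+; *-distribˡ-sum; *-distribʳ-sum)
  renaming (sum to ∑)
open import Data.Fin using (Fin; zero; suc; remQuot; quotient; remainder; combine; splitAt)
open import Data.Fin.Properties using (remQuot-combine)
open import Data.Vec as Vec using (tabulate)
open import Data.Vec.Functional using (Vector; _++_; concat)
open import Data.Product using (∃; _×_; _,_; proj₁; proj₂)
open import Data.Sum using (_⊎_; inj₁; inj₂)
open import Function using (_∘_)
open import Relation.Nullary using (¬_)
open import Relation.Binary.PropositionalEquality

private
  variable
    k l : ℕ

sum-tabulate : (f : Vector ℕ k) → Vec.sum (tabulate f) ≡ ∑ f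
sum-tabulate {ℕ.zero}  f = refl
sum-tabulate {ℕ.suc k} f = cong (f zero +_) (sum-tabulate (f ∘ suc))

∑-++ : (xs : Vector ℕ k) (ys : Vector ℕ l) → ∑ (xs ++ ys) ≡ ∑ xs + ∑ ys
∑-++ {ℕ.zero}  xs ys = refl
∑-++ {ℕ.suc k} xs ys = begin
  xs zero + ∑ (λ i → (xs ++ ys) (suc i))  ≡⟨ cong (xs zero +_) (sum-cong-≗ ++-suc) ⟩
  xs zero + ∑ ((xs ∘ suc) ++ ys)          ≡⟨ cong (xs zero +_) (∑-++ (xs ∘ suc) ys) ⟩
  xs zero + (∑ (xs ∘ suc) + ∑ ys)         ≡⟨ +-assoc (xs zero) _ _ ⟨
  ∑ xs + ∑ ys                              ∎
  where
  open ≡-Reasoning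
  ++-suc : ∀ i → (xs ++ ys) (suc i) ≡ ((xs ∘ suc) ++ ys) i
  ++-suc i with splitAt k i
  ... | inj₁ _ = refl
  ... | inj₂ _ = refl

∑-concat : (xss : Vector (Vector ℕ l) k) → ∑ (concat xss) ≡ ∑ (∑ ∘ xss)
∑-concat {k = ℕ.zero}  xss = refl
∑-concat {l} {ℕ.suc k} xss = begin
  ∑ (concat xss)                         ≡⟨ sum-cong-≗ concat-suc ⟩
  ∑ (xss zero ++ concat (xss ∘ suc))     ≡⟨ ∑-++ (xss zero) _ ⟩
  ∑ (xss zero) + ∑ (concat (xss ∘ suc))  ≡⟨ cong (∑ (xss zero) +_) (∑-concat (xss ∘ suc)) ⟩
  ∑ (∑ ∘ xss)                            ∎
  where
  open ≡-Reasoning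
  concat-suc : ∀ i → concat xss i ≡ (xss zero ++ concat (xss ∘ suc)) i
  concat-suc i with splitAt l i
  ... | inj₁ _ = refl
  ... | inj₂ _ = refl

concat-cong : {A : Set} {F F′ : Vector (Vector A l) k} → (∀ i j → F i j ≡ F′ i j) → concat F ≗ concat F′
concat-cong {k = k} {F = F} F≗F′ x = F≗F′ (quotient {k} _ x) (remainder {k} _ x)

∑-outer-product : (x : Vector ℕ k) (y : Vector ℕ l) → ∑ (concat (λ i j → x i * y j)) ≡ ∑ x * ∑ y
∑-outer-product x y = begin
  ∑ (concat (λ i j → x i * y j))  ≡⟨ ∑-concat (λ i j → x i * y j) ⟩
  ∑ (λ i → ∑ (λ j → x i * y j))   ≡⟨ sum-cong-≗ (λ i → *-distribˡ-sum (x i) y) ⟨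
  ∑ (λ i → x i * ∑ y)             ≡⟨ *-distribʳ-sum (∑ y) x ⟨
  ∑ x * ∑ y                       ∎
  where open ≡-Reasoning

_⊙_ : Label → Label → Label
zero     ⊙ _        = zero
suc _    ⊙ zero     = zero
suc zero ⊙ suc zero = suc zero
suc _    ⊙ suc _    = two

⊙-val : ∀ a b → val (a ⊙ b) + 2 * isTwo a * isTwo b ≡ val a * val b
⊙-val zero                 _                    = refl
⊙-val (suc zero)           zero                 = refl
⊙-val (suc zero)           (suc zero)           = refl
⊙-val (suc zero)           (suc (suc zero))     = refl
⊙-val (suc (suc zero))     zero                 = refl
⊙-val (suc (suc zero))     (suc zero)           = refl
⊙-val (suc (suc zero))     (suc (suc zero))     = refl

⊙-zero : ∀ {a b} → a ⊙ b ≡ zero → a ≡ zero ⊎ b ≡ zero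
⊙-zero {zero}                            _  = inj₁ refl
⊙-zero {suc _}          {zero}           _  = inj₂ refl
⊙-zero {suc zero}       {suc zero}       ()
⊙-zero {suc zero}       {suc (suc zero)} ()
⊙-zero {suc (suc zero)} {suc zero}       ()
⊙-zero {suc (suc zero)} {suc (suc zero)} ()

promote : Label → Label
promote zero    = two
promote (suc a) = suc a

⊙-promote : ∀ a b → a ⊙ b ≡ zero → promote a ⊙ promote b ≡ two
⊙-promote zero             zero             _ = refl
⊙-promote zero             (suc zero)       _ = refl
⊙-promote zero             (suc (suc zero)) _ = refl
⊙-promote (suc zero)       zero             _ = refl
⊙-promote (suc (suc zero)) zero             _ = refl
⊙-promote (suc zero)       (suc zero)       ()
⊙-promote (suc zero)       (suc (suc zero)) ()
⊙-promote (suc (suc zero)) (suc zero)       ()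
⊙-promote (suc (suc zero)) (suc (suc zero)) ()

Closed : (G : Graph) → Fin' G → Fin' G → Set
Closed G g g′ = g ≡ g′ ⊎ Adj G g g′

promote-closedNeighbour : (G : Graph) {f : Fin' G → Label} → IsRDF G f → ∀ g →
  ∃ λ g′ → Closed G g g′ × f g′ ≡ promote (f g) × (f g ≡ zero → g ≢ g′)
promote-closedNeighbour G {f} rdf g with f g in fg≡
... | zero with rdf g fg≡
...   | u , g~u , fu≡2 = u , inj₂ g~u , fu≡2 , λ _ g≡u → adj-irrefl G (subst (Adj G g) (sym g≡u) g~u)
promote-closedNeighbour G rdf g | suc _ = g , inj₁ refl , fg≡ , λ ()

_⊗_ : (Fin k → Label) → (Fin l → Label) → Fin (k * l) → Label
_⊗_ {k} {l} f₁ f₂ x = f₁ (quotient {k} l x) ⊙ f₂ (remainder {k} l x)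

⊗-combine : (f₁ : Fin k → Label) (f₂ : Fin l → Label) (g : Fin k) (h : Fin l) →
  (f₁ ⊗ f₂) (combine g h) ≡ f₁ g ⊙ f₂ h
⊗-combine f₁ f₂ g h = cong (λ (g , h) → f₁ g ⊙ f₂ h) (remQuot-combine g h)

∑-val-⊗ : (f₁ : Fin k → Label) (f₂ : Fin l → Label) →
  ∑ (val ∘ (f₁ ⊗ f₂)) + 2 * ∑ (isTwo ∘ f₁) * ∑ (isTwo ∘ f₂) ≡ ∑ (val ∘ f₁) * ∑ (val ∘ f₂)
∑-val-⊗ f₁ f₂ = begin
  ∑ (val ∘ (f₁ ⊗ f₂)) + 2 * ∑ (isTwo ∘ f₁) * ∑ (isTwo ∘ f₂)
    ≡⟨ cong (λ s → ∑ (val ∘ (f₁ ⊗ f₂)) + s * ∑ (isTwo ∘ f₂)) (*-distribˡ-sum 2 (isTwo ∘ f₁)) ⟩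
  ∑ (val ∘ (f₁ ⊗ f₂)) + ∑ (λ g → 2 * isTwo (f₁ g)) * ∑ (isTwo ∘ f₂)
    ≡⟨ cong (∑ (val ∘ (f₁ ⊗ f₂)) +_) (∑-outer-product (λ g → 2 * isTwo (f₁ g)) (isTwo ∘ f₂)) ⟨
  ∑ (val ∘ (f₁ ⊗ f₂)) + ∑ (concat (λ g h → 2 * isTwo (f₁ g) * isTwo (f₂ h)))
    ≡⟨ ∑-distrib-+ (val ∘ (f₁ ⊗ f₂)) _ ⟨
  ∑ (concat (λ g h → val (f₁ g ⊙ f₂ h) + 2 * isTwo (f₁ g) * isTwo (f₂ h)))
    ≡⟨ sum-cong-≗ (concat-cong (λ g h → ⊙-val (f₁ g) (f₂ h))) ⟩
  ∑ (concat (λ g h → val (f₁ g) * val (f₂ h)))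
    ≡⟨ ∑-outer-product (val ∘ f₁) (val ∘ f₂) ⟩
  ∑ (val ∘ f₁) * ∑ (val ∘ f₂) ∎
  where open ≡-Reasoning

⊠-adjacent : (G H : Graph) (x : Fin' (G ⊠ H)) {g : Fin' G} {h : Fin' H} →
  Closed G (quotient {n G} (n H) x) g → Closed H (remainder {n G} (n H) x) h →
  ¬ (quotient {n G} (n H) x ≡ g × remainder {n G} (n H) x ≡ h) →
  Adj (G ⊠ H) x (combine g h)
⊠-adjacent G H x {g} {h} x~g x~h ne =
  x≢gh , subst (Closed G _ ∘ proj₁) (sym gh-coords) x~g , subst (Closed H _ ∘ proj₂) (sym gh-coords) x~h
  where
  gh-coords : remQuot (n H) (combine g h) ≡ (g , h)
  gh-coords = remQuot-combine g h
  x≢gh : x ≢ combine g h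
  x≢gh x≡gh = ne ( trans (cong (quotient {n G} (n H)) x≡gh) (cong proj₁ gh-coords)
                 , trans (cong (remainder {n G} (n H)) x≡gh) (cong proj₂ gh-coords))

⊗-isRDF : (G H : Graph) {f₁ : Fin' G → Label} {f₂ : Fin' H → Label} →
  IsRDF G f₁ → IsRDF H f₂ → IsRDF (G ⊠ H) (f₁ ⊗ f₂)
⊗-isRDF G H {f₁} {f₂} rdf₁ rdf₂ x x↦0
  with promote-closedNeighbour G rdf₁ (quotient {n G} (n H) x)
     | promote-closedNeighbour H rdf₂ (remainder {n G} (n H) x)
... | g , x~g , fg≡ , moved₁ | h , x~h , fh≡ , moved₂ =
  combine g h , ⊠-adjacent G H x x~g x~h distinct , gh↦2
  where
  distinct : ¬ (quotient {n G} (n H) x ≡ g × remainder {n G} (n H) x ≡ h)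
  distinct (≡g , ≡h) with ⊙-zero x↦0
  ... | inj₁ f₁≡0 = moved₁ f₁≡0 ≡g
  ... | inj₂ f₂≡0 = moved₂ f₂≡0 ≡h
  gh↦2 : (f₁ ⊗ f₂) (combine g h) ≡ two
  gh↦2 = begin
    (f₁ ⊗ f₂) (combine g h)  ≡⟨ ⊗-combine f₁ f₂ g h ⟩
    f₁ g ⊙ f₂ h              ≡⟨ cong₂ _⊙_ fg≡ fh≡ ⟩
    promote (f₁ (quotient {n G} (n H) x)) ⊙ promote (f₂ (remainder {n G} (n H) x))
                             ≡⟨ ⊙-promote _ _ x↦0 ⟩
    two                      ∎
    where open ≡-Reasoning

⊗-weight : (G H : Graph) (f₁ : Fin' G → Label) (f₂ : Fin' H → Label) →
  weight (G ⊠ H) (f₁ ⊗ f₂) ≡ weight G f₁ * weight H f₂ ∸ 2 * card₂ G f₁ * card₂ H f₂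
⊗-weight G H f₁ f₂ = begin
  weight (G ⊠ H) (f₁ ⊗ f₂)                      ≡⟨ m+n∸n≡m _ c ⟨
  weight (G ⊠ H) (f₁ ⊗ f₂) + c ∸ c              ≡⟨ cong (_∸ c) weight-identity ⟩
  weight G f₁ * weight H f₂ ∸ c                 ∎
  where
  open ≡-Reasoning
  c = 2 * card₂ G f₁ * card₂ H f₂
  weight-identity : weight (G ⊠ H) (f₁ ⊗ f₂) + c ≡ weight G f₁ * weight H f₂
  weight-identity
    rewrite sum-tabulate (val ∘ (f₁ ⊗ f₂)) | sum-tabulate (isTwo ∘ f₁) | sum-tabulate (isTwo ∘ f₂)
          | sum-tabulate (val ∘ f₁) | sum-tabulate (val ∘ f₂)
    = ∑-val-⊗ f₁ f₂

theorem23 : (G H : Graph)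
    → (f₁ : Fin' G → Label) → IsMinRDF G f₁
    → (f₂ : Fin' H → Label) → IsMinRDF H f₂
    → (k : ℕ) → IsRomanDomNumber (G ⊠ H) k
    → k ≤ weight G f₁ * weight H f₂ ∸ 2 * card₂ G f₁ * card₂ H f₂
theorem23 G H f₁ (rdf₁ , _) f₂ (rdf₂ , _) k (_ , k≤rdf) =
  ≤-trans (k≤rdf (f₁ ⊗ f₂) (⊗-isRDF G H rdf₁ rdf₂)) (≤-reflexive (⊗-weight G H f₁ f₂))
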